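{- Let $k\ge 2$ and let $\pi\in\mathcal{S}_{\binom{k}{2}}$. If the insertion tableau $P(\pi)$ does not have shape $(k-1,k-2,\dots,1)$, then the word $\pi\pi^r$ contains an increasing subsequence of length $k$.
   Context: $\mathcal{S}_n$ is the set of permutations of $[n]$; $\pi^r$ denotes the reversal of $\pi$ and $\pi\pi^r$ the concatenation of $\pi$ with its reversal. $P(\pi)$ is the insertion tableau associated to $\pi$ by the Robinson–Schensted correspondence (Schensted row insertion of $\pi_1,\pi_2,\dots,\pi_n$ in order, where an inserted value bumps the leftmost larger entry of a row into the next row). An increasing subsequence of a word is a subsequence whose entries are strictly increasing. -}

module Defs where

open import Data.Nat using (ℕ; zero; suc; _∸_; _<_; _<?_)
open import Data.Fin using (Fin; toℕ)
open import Data.Fin.Permutation using (Permutation′; _⟨$⟩ʳ_)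
open import Data.List using (List; []; _∷_; _++_; map; foldl; reverse; downFrom; length; allFin)
open import Data.List.Relation.Binary.Sublist.Propositional using (_⊆_)
open import Data.List.Relation.Unary.Linked using (Linked)
open import Data.Maybe using (Maybe; just; nothing)
open import Data.Product using (_×_; _,_; Σ)
open import Relation.Nullary using (yes; no)

-- A permutation π of [n] viewed as the word π(1) π(2) … π(n).
-- Values are shifted to 0,…,n-1 (order preserving, irrelevant for the statement).
word : ∀ {n} → Permutation′ n → List ℕ
word {n} π = map (λ i → toℕ (π ⟨$⟩ʳ i)) (allFin n)

-- Tableau as a list of rows (top row first).
Tableau : Set
Tableau = List (List ℕ)

rowInsert : ℕ → List ℕ → List ℕ × Maybe ℕ
rowInsert x [] = (x ∷ [] , nothing)
rowInsert x (y ∷ ys) with x <? y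
... | yes _ = (x ∷ ys , just y)
... | no _ with rowInsert x ys
...   | (r , b) = (y ∷ r , b)

mutual
  insert : ℕ → Tableau → Tableau
  insert x [] = (x ∷ []) ∷ []
  insert x (r ∷ rs) = continue (rowInsert x r) rs

  continue : List ℕ × Maybe ℕ → Tableau → Tableau
  continue (r′ , nothing) rs = r′ ∷ rs
  continue (r′ , just y) rs = r′ ∷ insert y rs

P : List ℕ → Tableau
P w = foldl (λ t x → insert x t) [] w

shape : Tableau → List ℕ
shape = map length

staircase : ℕ → List ℕ
staircase k = map suc (downFrom (k ∸ 1))

Increasing : List ℕ → Set
Increasing = Linked _<_

HasIncSubseq : ℕ → List ℕ → Set
HasIncSubseq k w = Σ (List ℕ) λ s → (s ⊆ w) × Increasing s × (length s ≡ k)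
  where open import Relation.Binary.PropositionalEquality using (_≡_)

-- An elementary Knuth move changes a word w inside a window of three letters
-- (yxz ↔ yzx or xzy ↔ zxy with x < y < z), and changes the reverse of w inside the
-- reversed window, which is again of one of these kinds. Every increasing
-- subsequence through such a window can be rerouted through the replacement
-- window with the same length and a first entry that is not smaller, so whether
-- w ++ reverse w has an increasing subsequence of length k depends only on the
-- Knuth class of w. Hence π may be replaced by the reading word of P(π).
-- Since P(π) has k(k-1)/2 boxes, a shape other than the staircase has a box in
-- some row i and column q with q + i = k - 1. In the doubled reading word, the
-- first q entries of the top row, followed by column q read downwards from the
-- top row to row i, form an increasing subsequence of length k.

module Submission where

open import Defs
open import Data.Empty using (⊥-elim)
open import Data.Fin using (toℕ)
open import Data.Fin.Permutation using (Permutation′; _⟨$⟩ʳ_; _⟨$⟩ˡ_; inverseˡ)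
open import Data.Fin.Properties using (toℕ-injective)
open import Data.List using (List; []; _∷_; _++_; [_]; reverse; length; head; foldl; allFin)
open import Data.List.Properties using (++-assoc; ++-identityʳ; ++-monoid; reverse-++; length-++; length-map; length-tabulate)
open import Data.List.Membership.Propositional using (_∉_)
open import Data.List.Membership.Propositional.Properties using (∈-++⁺ʳ)
open import Data.List.Relation.Binary.Permutation.Propositional using (_↭_; ↭-isEquivalence; ↭-refl; ↭-sym; ↭⇒↭ₛ; prep; swap)
open import Data.List.Relation.Binary.Permutation.Propositional.Properties using (↭-length; zoom; ∷↭∷ʳ)
import Data.List.Relation.Binary.Permutation.Propositional.Properties as ↭
import Data.List.Relation.Binary.Permutation.Setoid.Properties as ↭ₛ
open import Data.List.Relation.Binary.Prefix.Heterogeneous using (Prefix; []; _∷_)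
open import Data.List.Relation.Binary.Sublist.Propositional using (_⊆_; []; _∷_; _∷ʳ_; minimum; ⊆-refl)
open import Data.List.Relation.Binary.Sublist.Propositional.Properties using (++⁺; ++⁺ˡ; ++⁺ʳ; reverse⁺; All-resp-⊆)
open import Data.List.Relation.Unary.All using (All; []; _∷_)
import Data.List.Relation.Unary.All as All
import Data.List.Relation.Unary.All.Properties as All
open import Data.List.Relation.Unary.Any using (here; there)
open import Data.List.Relation.Unary.Linked using (Linked; []; [-]; _∷_; head′; tail; _∷′_)
open import Data.List.Relation.Unary.AllPairs using ([]; _∷_)
open import Data.List.Relation.Unary.Unique.Propositional using (Unique)
open import Data.List.Relation.Unary.Unique.Propositional.Properties as Unique using (Unique[x∷xs]⇒x∉xs)
open import Data.Maybe using (Maybe; just; nothing)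
open import Data.Maybe.Relation.Binary.Connected using (Connected; just; nothing-just; nothing)
open import Data.Nat using (ℕ; zero; suc; _+_; _<_; _>_; _≤_; _≤?_; _<?_; z≤n; s≤s; z<s)
open import Data.Nat.Combinatorics using (_C_; nC1≡n; nCk+nC[k+1]≡[n+1]C[k+1])
open import Data.Nat.ListAction using (sum)
open import Data.Nat.Properties using (<-trans; <-asym; <⇒≤; <⇒≱; ≤-<-trans; <-≤-trans; ≤-trans; ≤-antisym; ≤-reflexive; ≮⇒≥; ≰⇒>; ≤∧≢⇒<; +-suc; +-identityʳ; +-comm; +-cancelˡ-≤; +-cancelʳ-≤; +-monoʳ-≤; +-mono-≤; m≤m+n)
open import Data.Product using (Σ; ∃; ∃₂; _×_; _,_; proj₁; proj₂)
open import Data.Sum using (_⊎_; inj₁; inj₂)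
open import Function using (_∘_; id; flip)
open import Relation.Binary.Construct.Closure.Equivalence using (EqClosure)
import Relation.Binary.Construct.Closure.Equivalence as EqClosure
open import Relation.Binary.Construct.Closure.ReflexiveTransitive using (ε; _◅_; _◅◅_)
open import Relation.Binary.Construct.Closure.Symmetric using (fwd; bwd)
open import Relation.Binary.PropositionalEquality using (_≡_; _≢_; refl; sym; trans; cong; cong₂; subst; setoid; module ≡-Reasoning)
open import Relation.Nullary using (¬_; yes; no)
import Relation.Binary.Reasoning.Setoid as SetoidReasoning
open import Tactic.MonoidSolver using (solve)

Linked-splice : ∀ {A : Set} {R : A → A → Set} {a} xs {ys zs} →
                Linked R (xs ++ a ∷ ys) → Linked R (a ∷ zs) → Linked R (xs ++ a ∷ zs)
Linked-splice []           _             R[a∷zs] = R[a∷zs]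
Linked-splice (x ∷ [])     (Rxa ∷ _)     R[a∷zs] = Rxa ∷ R[a∷zs]
Linked-splice (x ∷ y ∷ xs) (Rxy ∷ R[xs]) R[a∷zs] = Rxy ∷ Linked-splice (y ∷ xs) R[xs] R[a∷zs]

Unique-resp-⊇ : ∀ {A : Set} {xs ys : List A} → xs ⊆ ys → Unique ys → Unique xs
Unique-resp-⊇ []         []         = []
Unique-resp-⊇ (_ ∷ʳ xs⊆) (_ ∷ u)    = Unique-resp-⊇ xs⊆ u
Unique-resp-⊇ (refl ∷ xs⊆) (x≢ ∷ u) = All-resp-⊆ xs⊆ x≢ ∷ Unique-resp-⊇ xs⊆ u

Unique-resp-↭ : ∀ {A : Set} {xs ys : List A} → xs ↭ ys → Unique xs → Unique ys
Unique-resp-↭ = ↭ₛ.Unique-resp-↭ (setoid _) ∘ ↭⇒↭ₛ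

Unique-∷ʳ⇒∉ : ∀ {A : Set} {x : A} xs → Unique (xs ++ [ x ]) → x ∉ xs
Unique-∷ʳ⇒∉ {x = x} xs = Unique[x∷xs]⇒x∉xs ∘ Unique-resp-↭ (↭-sym (∷↭∷ʳ x xs))

≤-+-squeeze : ∀ {a b c d} → a ≤ b → c ≤ d → b + d ≤ a + c → a ≡ b × d ≤ c
≤-+-squeeze {a} {b} {c} {d} a≤b c≤d b+d≤a+c =
  a≡b , +-cancelˡ-≤ b d c (subst (λ x → b + d ≤ x + c) a≡b b+d≤a+c)
  where
  a≡b : a ≡ b
  a≡b = ≤-antisym a≤b (+-cancelʳ-≤ d b a (≤-trans b+d≤a+c (+-monoʳ-≤ a c≤d)))

-- Increasing subsequences under window substitution

-- The optional lower bound on the first entry is what lets a window be replaced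
-- behind an arbitrary prefix (↝-inContext).
IncSubseqAbove : Maybe ℕ → ℕ → List ℕ → Set
IncSubseqAbove m n w = Σ (List ℕ) λ s → s ⊆ w × Connected _<_ m (head s) × Increasing s × length s ≡ n

Connected-nothing : ∀ s → Connected _<_ nothing (head s)
Connected-nothing []      = nothing
Connected-nothing (_ ∷ _) = nothing-just

Connected-raise : ∀ {m a b} → Connected _<_ m (just a) → a ≤ b → Connected _<_ m (just b)
Connected-raise (just l<a)   a≤b = just (<-≤-trans l<a a≤b)
Connected-raise nothing-just _   = nothing-just

Increasing-lowerHead : ∀ {y z t} → y < z → Increasing (z ∷ t) → Increasing (y ∷ t)
Increasing-lowerHead _   [-]         = [-]
Increasing-lowerHead y<z (z<w ∷ inc) = <-trans y<z z<w ∷ inc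

infix 4 _↝_

_↝_ : List ℕ → List ℕ → Set
W ↝ W′ = ∀ {m n} post → IncSubseqAbove m n (W ++ post) → IncSubseqAbove m n (W′ ++ post)

↝-inContext : ∀ {W W′ m n} → W ↝ W′ → ∀ pre post →
              IncSubseqAbove m n (pre ++ W ++ post) → IncSubseqAbove m n (pre ++ W′ ++ post)
↝-inContext w []        post = w post
↝-inContext w (a ∷ pre) post (s , _ ∷ʳ sub , rest) with ↝-inContext w pre post (s , sub , rest)
... | s′ , sub′ , rest′ = s′ , a ∷ʳ sub′ , rest′
↝-inContext w (a ∷ pre) post (a ∷ s , refl ∷ sub , bound , inc , refl)
  with ↝-inContext w pre post (s , sub , head′ inc , tail inc , refl)
... | s′ , sub′ , bound′ , inc′ , len′ = a ∷ s′ , refl ∷ sub′ , bound , bound′ ∷′ inc′ , cong suc len′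

↝-hasIncSubseq : ∀ {W W′ n} → W ↝ W′ → ∀ pre post →
                 HasIncSubseq n (pre ++ W ++ post) → HasIncSubseq n (pre ++ W′ ++ post)
↝-hasIncSubseq w pre post (s , sub , inc , len)
  with ↝-inContext w pre post (s , sub , Connected-nothing s , inc , len)
... | s′ , sub′ , _ , inc′ , len′ = s′ , sub′ , inc′ , len′

module _ {x y z : ℕ} (x<y : x < y) (y<z : y < z) where

  private
    x<z : x < z
    x<z = <-trans x<y y<z

  yxz↝yzx : y ∷ x ∷ z ∷ [] ↝ y ∷ z ∷ x ∷ []
  yxz↝yzx _ (s , _ ∷ʳ _ ∷ʳ _ ∷ʳ q , r)          = s , y ∷ʳ z ∷ʳ x ∷ʳ q , r
  yxz↝yzx _ (s , _ ∷ʳ _ ∷ʳ refl ∷ q , r)        = s , y ∷ʳ refl ∷ x ∷ʳ q , r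
  yxz↝yzx _ (s , _ ∷ʳ refl ∷ _ ∷ʳ q , r)        = s , y ∷ʳ z ∷ʳ refl ∷ q , r
  yxz↝yzx _ (_ ∷ _ ∷ t , _ ∷ʳ refl ∷ refl ∷ q , bound , _ ∷ inc , len) =
    y ∷ z ∷ t , refl ∷ refl ∷ x ∷ʳ q , Connected-raise bound (<⇒≤ x<y) , y<z ∷ inc , len
  yxz↝yzx _ (s , refl ∷ _ ∷ʳ _ ∷ʳ q , r)        = s , refl ∷ z ∷ʳ x ∷ʳ q , r
  yxz↝yzx _ (s , refl ∷ _ ∷ʳ refl ∷ q , r)      = s , refl ∷ refl ∷ x ∷ʳ q , r
  yxz↝yzx _ (_ , refl ∷ refl ∷ _ , _ , y<x ∷ _ , _) = ⊥-elim (<-asym x<y y<x)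

  yzx↝yxz : y ∷ z ∷ x ∷ [] ↝ y ∷ x ∷ z ∷ []
  yzx↝yxz _ (s , _ ∷ʳ _ ∷ʳ _ ∷ʳ q , r)          = s , y ∷ʳ x ∷ʳ z ∷ʳ q , r
  yzx↝yxz _ (s , _ ∷ʳ _ ∷ʳ refl ∷ q , r)        = s , y ∷ʳ refl ∷ z ∷ʳ q , r
  yzx↝yxz _ (s , _ ∷ʳ refl ∷ _ ∷ʳ q , r)        = s , y ∷ʳ x ∷ʳ refl ∷ q , r
  yzx↝yxz _ (_ , _ ∷ʳ refl ∷ refl ∷ _ , _ , z<x ∷ _ , _) = ⊥-elim (<-asym x<z z<x)
  yzx↝yxz _ (s , refl ∷ _ ∷ʳ _ ∷ʳ q , r)        = s , refl ∷ x ∷ʳ z ∷ʳ q , r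
  yzx↝yxz _ (_ , refl ∷ _ ∷ʳ refl ∷ _ , _ , y<x ∷ _ , _) = ⊥-elim (<-asym x<y y<x)
  yzx↝yxz _ (s , refl ∷ refl ∷ _ ∷ʳ q , r)      = s , refl ∷ x ∷ʳ refl ∷ q , r
  yzx↝yxz _ (_ , refl ∷ refl ∷ refl ∷ _ , _ , _ ∷ z<x ∷ _ , _) = ⊥-elim (<-asym x<z z<x)

  xzy↝zxy : x ∷ z ∷ y ∷ [] ↝ z ∷ x ∷ y ∷ []
  xzy↝zxy _ (s , _ ∷ʳ _ ∷ʳ _ ∷ʳ q , r)          = s , z ∷ʳ x ∷ʳ y ∷ʳ q , r
  xzy↝zxy _ (s , _ ∷ʳ _ ∷ʳ refl ∷ q , r)        = s , z ∷ʳ x ∷ʳ refl ∷ q , r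
  xzy↝zxy _ (s , _ ∷ʳ refl ∷ _ ∷ʳ q , r)        = s , refl ∷ x ∷ʳ y ∷ʳ q , r
  xzy↝zxy _ (_ , _ ∷ʳ refl ∷ refl ∷ _ , _ , z<y ∷ _ , _) = ⊥-elim (<-asym y<z z<y)
  xzy↝zxy _ (s , refl ∷ _ ∷ʳ _ ∷ʳ q , r)        = s , z ∷ʳ refl ∷ y ∷ʳ q , r
  xzy↝zxy _ (s , refl ∷ _ ∷ʳ refl ∷ q , r)      = s , z ∷ʳ refl ∷ refl ∷ q , r
  xzy↝zxy _ (_ ∷ _ ∷ t , refl ∷ refl ∷ _ ∷ʳ q , bound , _ ∷ inc , len) =
    x ∷ y ∷ t , z ∷ʳ refl ∷ refl ∷ q , bound , x<y ∷ Increasing-lowerHead y<z inc , len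
  xzy↝zxy _ (_ , refl ∷ refl ∷ refl ∷ _ , _ , _ ∷ z<y ∷ _ , _) = ⊥-elim (<-asym y<z z<y)

  zxy↝xzy : z ∷ x ∷ y ∷ [] ↝ x ∷ z ∷ y ∷ []
  zxy↝xzy _ (s , _ ∷ʳ _ ∷ʳ _ ∷ʳ q , r)          = s , x ∷ʳ z ∷ʳ y ∷ʳ q , r
  zxy↝xzy _ (s , _ ∷ʳ _ ∷ʳ refl ∷ q , r)        = s , x ∷ʳ z ∷ʳ refl ∷ q , r
  zxy↝xzy _ (s , _ ∷ʳ refl ∷ _ ∷ʳ q , r)        = s , refl ∷ z ∷ʳ y ∷ʳ q , r
  zxy↝xzy _ (s , _ ∷ʳ refl ∷ refl ∷ q , r)      = s , refl ∷ z ∷ʳ refl ∷ q , r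
  zxy↝xzy _ (s , refl ∷ _ ∷ʳ _ ∷ʳ q , r)        = s , x ∷ʳ refl ∷ y ∷ʳ q , r
  zxy↝xzy _ (_ , refl ∷ _ ∷ʳ refl ∷ _ , _ , z<y ∷ _ , _) = ⊥-elim (<-asym y<z z<y)
  zxy↝xzy _ (_ , refl ∷ refl ∷ _ , _ , z<x ∷ _ , _) = ⊥-elim (<-asym x<z z<x)

-- Knuth equivalence

data KnuthMove : List ℕ → List ℕ → Set where
  yxz↦yzx : ∀ u v {x y z} → x < y → y < z → KnuthMove (u ++ y ∷ x ∷ z ∷ v) (u ++ y ∷ z ∷ x ∷ v)
  xzy↦zxy : ∀ u v {x y z} → x < y → y < z → KnuthMove (u ++ x ∷ z ∷ y ∷ v) (u ++ z ∷ x ∷ y ∷ v)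

infix 4 _≈ᴷ_

_≈ᴷ_ : List ℕ → List ℕ → Set
_≈ᴷ_ = EqClosure KnuthMove

≡⇒≈ᴷ : ∀ {a b} → a ≡ b → a ≈ᴷ b
≡⇒≈ᴷ refl = ε

module ≈ᴷ-Reasoning = SetoidReasoning (EqClosure.setoid KnuthMove)

≈ᴷ-sym : ∀ {a b} → a ≈ᴷ b → b ≈ᴷ a
≈ᴷ-sym = EqClosure.symmetric KnuthMove

KnuthMove-++ˡ : ∀ t {a b} → KnuthMove a b → KnuthMove (t ++ a) (t ++ b)
KnuthMove-++ˡ t (yxz↦yzx u v {x} {y} {z} x<y y<z)
  rewrite sym (++-assoc t u (y ∷ x ∷ z ∷ v)) | sym (++-assoc t u (y ∷ z ∷ x ∷ v)) = yxz↦yzx (t ++ u) v x<y y<z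
KnuthMove-++ˡ t (xzy↦zxy u v {x} {y} {z} x<y y<z)
  rewrite sym (++-assoc t u (x ∷ z ∷ y ∷ v)) | sym (++-assoc t u (z ∷ x ∷ y ∷ v)) = xzy↦zxy (t ++ u) v x<y y<z

KnuthMove-++ʳ : ∀ t {a b} → KnuthMove a b → KnuthMove (a ++ t) (b ++ t)
KnuthMove-++ʳ t (yxz↦yzx u v {x} {y} {z} x<y y<z)
  rewrite ++-assoc u (y ∷ x ∷ z ∷ v) t | ++-assoc u (y ∷ z ∷ x ∷ v) t = yxz↦yzx u (v ++ t) x<y y<z
KnuthMove-++ʳ t (xzy↦zxy u v {x} {y} {z} x<y y<z)
  rewrite ++-assoc u (x ∷ z ∷ y ∷ v) t | ++-assoc u (z ∷ x ∷ y ∷ v) t = xzy↦zxy u (v ++ t) x<y y<z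

≈ᴷ-++ˡ : ∀ t {a b} → a ≈ᴷ b → t ++ a ≈ᴷ t ++ b
≈ᴷ-++ˡ t = EqClosure.gmap (t ++_) (KnuthMove-++ˡ t)

≈ᴷ-++ʳ : ∀ t {a b} → a ≈ᴷ b → a ++ t ≈ᴷ b ++ t
≈ᴷ-++ʳ t = EqClosure.gmap (_++ t) (KnuthMove-++ʳ t)

KnuthMove⇒↭ : ∀ {a b} → KnuthMove a b → a ↭ b
KnuthMove⇒↭ (yxz↦yzx u v {x} {y} {z} _ _) = zoom u {v} {y ∷ x ∷ z ∷ []} (prep y (swap x z ↭-refl))
KnuthMove⇒↭ (xzy↦zxy u v {x} {y} {z} _ _) = zoom u {v} {x ∷ z ∷ y ∷ []} (swap x z ↭-refl)

≈ᴷ⇒↭ : ∀ {a b} → a ≈ᴷ b → a ↭ b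
≈ᴷ⇒↭ = EqClosure.fold ↭-isEquivalence KnuthMove⇒↭

Doubled : ℕ → List ℕ → Set
Doubled n w = HasIncSubseq n (w ++ reverse w)

doubled-++ : ∀ u X v → (u ++ X ++ v) ++ reverse (u ++ X ++ v) ≡ u ++ X ++ (v ++ reverse v ++ reverse X ++ reverse u)
doubled-++ u X v = begin
  (u ++ X ++ v) ++ reverse (u ++ X ++ v)                  ≡⟨ cong ((u ++ X ++ v) ++_) (reverse-++ u (X ++ v)) ⟩
  (u ++ X ++ v) ++ reverse (X ++ v) ++ reverse u          ≡⟨ cong (λ r → (u ++ X ++ v) ++ r ++ reverse u) (reverse-++ X v) ⟩
  (u ++ X ++ v) ++ (reverse v ++ reverse X) ++ reverse u  ≡⟨ solve (++-monoid ℕ) ⟩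
  u ++ X ++ (v ++ reverse v ++ reverse X ++ reverse u)    ∎
  where open ≡-Reasoning

↝-doubled : ∀ {n W W′} → W ↝ W′ → reverse W ↝ reverse W′ →
            ∀ u v → Doubled n (u ++ W ++ v) → Doubled n (u ++ W′ ++ v)
↝-doubled {n} {W} {W′} W↝W′ Wʳ↝W′ʳ u v =
    subst (HasIncSubseq n) (sym (doubled-++ u W′ v))
  ∘ subst (HasIncSubseq n) (sym (reassoc (reverse W′)))
  ∘ ↝-hasIncSubseq Wʳ↝W′ʳ (u ++ W′ ++ v ++ reverse v) (reverse u)
  ∘ subst (HasIncSubseq n) (reassoc (reverse W))
  ∘ ↝-hasIncSubseq W↝W′ u (v ++ reverse v ++ reverse W ++ reverse u)
  ∘ subst (HasIncSubseq n) (doubled-++ u W v)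
  where
  reassoc : ∀ Y → u ++ W′ ++ (v ++ reverse v ++ Y ++ reverse u) ≡ (u ++ W′ ++ v ++ reverse v) ++ Y ++ reverse u
  reassoc Y = solve (++-monoid ℕ)

KnuthMove-doubled : ∀ {n a b} → KnuthMove a b → Doubled n a → Doubled n b
KnuthMove-doubled (yxz↦yzx u v x<y y<z) = ↝-doubled (yxz↝yzx x<y y<z) (zxy↝xzy x<y y<z) u v
KnuthMove-doubled (xzy↦zxy u v x<y y<z) = ↝-doubled (xzy↝zxy x<y y<z) (yzx↝yxz x<y y<z) u v

KnuthMove-doubled˘ : ∀ {n a b} → KnuthMove b a → Doubled n a → Doubled n b
KnuthMove-doubled˘ (yxz↦yzx u v x<y y<z) = ↝-doubled (yzx↝yxz x<y y<z) (xzy↝zxy x<y y<z) u v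
KnuthMove-doubled˘ (xzy↦zxy u v x<y y<z) = ↝-doubled (zxy↝xzy x<y y<z) (yxz↝yzx x<y y<z) u v

≈ᴷ-doubled : ∀ {n a b} → a ≈ᴷ b → Doubled n a → Doubled n b
≈ᴷ-doubled ε              = id
≈ᴷ-doubled (fwd m ◅ a≈b) = ≈ᴷ-doubled a≈b ∘ KnuthMove-doubled m
≈ᴷ-doubled (bwd m ◅ a≈b) = ≈ᴷ-doubled a≈b ∘ KnuthMove-doubled˘ m

-- Row insertion

data RowInsert (x : ℕ) : List ℕ → List ℕ → Maybe ℕ → Set where
  append : RowInsert x [] (x ∷ []) nothing
  bump   : ∀ {y ys} → x < y → RowInsert x (y ∷ ys) (x ∷ ys) (just y)
  skip   : ∀ {y ys r mb} → ¬ x < y → RowInsert x ys r mb → RowInsert x (y ∷ ys) (y ∷ r) mb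

rowInsert-view : ∀ x r → RowInsert x r (proj₁ (rowInsert x r)) (proj₂ (rowInsert x r))
rowInsert-view x []       = append
rowInsert-view x (y ∷ ys) with x <? y
... | yes x<y = bump x<y
... | no x≮y with rowInsert x ys | rowInsert-view x ys
...   | _ , _ | view = skip x≮y view

RowInsert-appended : ∀ {x r r′} → RowInsert x r r′ nothing → r′ ≡ r ++ [ x ]
RowInsert-appended append       = refl
RowInsert-appended (skip _ ins) = cong (_ ∷_) (RowInsert-appended ins)

RowInsert-nonEmpty : ∀ {x r r′ mb} → RowInsert x r r′ mb → 0 < length r′
RowInsert-nonEmpty append     = z<s
RowInsert-nonEmpty (bump _)   = z<s
RowInsert-nonEmpty (skip _ _) = z<s

RowInsert-bumped-> : ∀ {x r r′ b} → RowInsert x r r′ (just b) → x < b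
RowInsert-bumped-> (bump x<b)   = x<b
RowInsert-bumped-> (skip _ ins) = RowInsert-bumped-> ins

RowInsert-bumped-⊆ : ∀ {x r r′ b} → RowInsert x r r′ (just b) → [ b ] ⊆ r
RowInsert-bumped-⊆ (bump _)         = refl ∷ minimum _
RowInsert-bumped-⊆ (skip {y} _ ins) = y ∷ʳ RowInsert-bumped-⊆ ins

skipped<bumped : ∀ {x y ys r b} → ¬ x < y → RowInsert x ys r (just b) → y < b
skipped<bumped x≮y ins = ≤-<-trans (≮⇒≥ x≮y) (RowInsert-bumped-> ins)

skipped<inserted : ∀ {x y ys} → ¬ x < y → x ∉ y ∷ ys → y < x
skipped<inserted x≮y x∉ = ≤∧≢⇒< (≮⇒≥ x≮y) (x∉ ∘ here ∘ sym)

RowInsert-head : ∀ {x ys r mb y} → RowInsert x ys r mb → y < x →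
                 Connected _<_ (just y) (head ys) → Connected _<_ (just y) (head r)
RowInsert-head append     y<x _     = just y<x
RowInsert-head (bump _)   y<x _     = just y<x
RowInsert-head (skip _ _) _   y<ys₀ = y<ys₀

RowInsert-increasing : ∀ {x r r′ mb} → Increasing r → x ∉ r → RowInsert x r r′ mb → Increasing r′
RowInsert-increasing _   _  append         = [-]
RowInsert-increasing inc _  (bump x<y)     = Increasing-lowerHead x<y inc
RowInsert-increasing inc x∉ (skip x≮y ins) =
  RowInsert-head ins (skipped<inserted x≮y x∉) (head′ inc) ∷′ RowInsert-increasing (tail inc) (x∉ ∘ there) ins

bumpedRow-head : ∀ {x ys r b y} → RowInsert x ys r (just b) → Connected _<_ (just y) (head ys) → y < x →
                 ∃₂ λ c t → r ≡ c ∷ t × y < c × c < b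
bumpedRow-head (bump x<b)     _          y<x = _ , _ , refl , y<x , x<b
bumpedRow-head (skip x≮c ins) (just y<c) _   = _ , _ , refl , y<c , skipped<bumped x≮c ins

≈ᴷ-moveLeft : ∀ {p x} vs → Increasing (p ∷ vs) → x < p → (p ∷ vs) ++ [ x ] ≈ᴷ p ∷ x ∷ vs
≈ᴷ-moveLeft []       _           _   = ε
≈ᴷ-moveLeft (v ∷ vs) (p<v ∷ inc) x<p =
  ≈ᴷ-++ˡ [ _ ] (≈ᴷ-moveLeft vs inc (<-trans x<p p<v)) ◅◅ (bwd (yxz↦yzx [] vs x<p p<v) ◅ ε)

RowInsert-knuth : ∀ {x r r′ b} → Increasing r → x ∉ r → RowInsert x r r′ (just b) → r ++ [ x ] ≈ᴷ b ∷ r′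
RowInsert-knuth inc _ (bump {ys = ys} x<y) = ≈ᴷ-moveLeft ys inc x<y
RowInsert-knuth {x} {y ∷ ys} inc x∉ (skip x≮y ins)
  with bumpedRow-head ins (head′ inc) (skipped<inserted x≮y x∉)
... | _ , t , refl , y<c , c<b =
  ≈ᴷ-++ˡ [ y ] (RowInsert-knuth (tail inc) (x∉ ∘ there) ins) ◅◅ (fwd (xzy↦zxy [] t y<c c<b) ◅ ε)

-- Insertion tableaux

reading : Tableau → List ℕ
reading []       = []
reading (r ∷ rs) = reading rs ++ r

infix 4 _◁_

-- r ◁ s : the row s may sit directly below the row r
_◁_ : List ℕ → List ℕ → Set
r ◁ s = Prefix _>_ s r

◁-RowInsert : ∀ {x r r′ s mb} → r ◁ s → RowInsert x r r′ mb → r′ ◁ s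
◁-RowInsert []            _            = []
◁-RowInsert (r₀<s₀ ∷ r◁s) (bump x<r₀)  = <-trans x<r₀ r₀<s₀ ∷ r◁s
◁-RowInsert (r₀<s₀ ∷ r◁s) (skip _ ins) = r₀<s₀ ∷ ◁-RowInsert r◁s ins

◁-bump : ∀ {x r r′ s s′ b mb} → r ◁ s → RowInsert x r r′ (just b) → RowInsert b s s′ mb → r′ ◁ s′
◁-bump []            (bump x<b)     append        = x<b ∷ []
◁-bump (_ ∷ r◁s)     (bump x<b)     (bump _)      = x<b ∷ r◁s
◁-bump (b<s₀ ∷ _)    (bump _)       (skip b≮s₀ _) = ⊥-elim (b≮s₀ b<s₀)
◁-bump []            (skip x≮y ins) append        = skipped<bumped x≮y ins ∷ []
◁-bump (_ ∷ r◁s)     (skip x≮y ins) (bump _)      = skipped<bumped x≮y ins ∷ ◁-RowInsert r◁s ins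
◁-bump (r₀<s₀ ∷ r◁s) (skip _ ins)   (skip _ ins′) = r₀<s₀ ∷ ◁-bump r◁s ins ins′

◁-lowerTop : ∀ {x s s′ ss mb} → RowInsert x s s′ mb → Linked _◁_ (s ∷ ss) → Linked _◁_ (s′ ∷ ss)
◁-lowerTop _   [-]         = [-]
◁-lowerTop ins (s◁t ∷ ◁ss) = ◁-RowInsert s◁t ins ∷ ◁ss

◁-insertBumped : ∀ {x r r′ b} rs → RowInsert x r r′ (just b) → Linked _◁_ (r ∷ rs) → Linked _◁_ (r′ ∷ insert b rs)
◁-insertBumped []       ins _ = ◁-bump [] ins append ∷ [-]
◁-insertBumped {b = b} (s ∷ ss) ins (r◁s ∷ ◁ss) with rowInsert b s | rowInsert-view b s
... | _ , nothing | ins′ = ◁-bump r◁s ins ins′ ∷ ◁-lowerTop ins′ ◁ss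
... | _ , just _  | ins′ = ◁-bump r◁s ins ins′ ∷ ◁-insertBumped ss ins′ ◁ss

record IsTableau (T : Tableau) : Set where
  field
    rowsIncreasing : All Increasing T
    columnsStrict  : Linked _◁_ T
    shapePositive  : All (0 <_) (shape T)

open IsTableau

isTableau-[] : IsTableau []
isTableau-[] = record { rowsIncreasing = [] ; columnsStrict = [] ; shapePositive = [] }

module _ {x : ℕ} {r : List ℕ} (rs : Tableau) (u : Unique ((reading rs ++ r) ++ [ x ])) where

  inserted∉topRow : x ∉ r
  inserted∉topRow = Unique-∷ʳ⇒∉ (reading rs ++ r) u ∘ ∈-++⁺ʳ (reading rs)

  bumped-unique : ∀ {b} → [ b ] ⊆ r → Unique (reading rs ++ [ b ])
  bumped-unique b∈r = Unique-resp-⊇ (++⁺ʳ [ x ] (++⁺ ⊆-refl b∈r)) u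

insert-rowsIncreasing : ∀ x T → All Increasing T → Unique (reading T ++ [ x ]) → All Increasing (insert x T)
insert-rowsIncreasing x [] _ _ = [-] ∷ []
insert-rowsIncreasing x (r ∷ rs) (inc ∷ incs) u with rowInsert x r | rowInsert-view x r
... | _ , nothing | ins = RowInsert-increasing inc (inserted∉topRow rs u) ins ∷ incs
... | _ , just b  | ins = RowInsert-increasing inc (inserted∉topRow rs u) ins
                        ∷ insert-rowsIncreasing b rs incs (bumped-unique rs u (RowInsert-bumped-⊆ ins))

insert-columnsStrict : ∀ x T → Linked _◁_ T → Linked _◁_ (insert x T)
insert-columnsStrict x []       _  = [-]
insert-columnsStrict x (r ∷ rs) ◁T with rowInsert x r | rowInsert-view x r
... | _ , nothing | ins = ◁-lowerTop ins ◁T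
... | _ , just _  | ins = ◁-insertBumped rs ins ◁T

insert-shapePositive : ∀ x T → All (0 <_) (shape T) → All (0 <_) (shape (insert x T))
insert-shapePositive x []       _          = z<s ∷ []
insert-shapePositive x (r ∷ rs) (_ ∷ pos) with rowInsert x r | rowInsert-view x r
... | _ , nothing | ins = RowInsert-nonEmpty ins ∷ pos
... | _ , just b  | ins = RowInsert-nonEmpty ins ∷ insert-shapePositive b rs pos

insert-isTableau : ∀ x T → IsTableau T → Unique (reading T ++ [ x ]) → IsTableau (insert x T)
insert-isTableau x T t u = record
  { rowsIncreasing = insert-rowsIncreasing x T (rowsIncreasing t) u
  ; columnsStrict  = insert-columnsStrict x T (columnsStrict t)
  ; shapePositive  = insert-shapePositive x T (shapePositive t)
  }

insert-knuth : ∀ x T → All Increasing T → Unique (reading T ++ [ x ]) → reading T ++ [ x ] ≈ᴷ reading (insert x T)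
insert-knuth x [] _ _ = ε
insert-knuth x (r ∷ rs) (inc ∷ incs) u with rowInsert x r | rowInsert-view x r
... | r′ , nothing | ins = ≡⇒≈ᴷ (begin
  (reading rs ++ r) ++ [ x ]  ≡⟨ ++-assoc (reading rs) r [ x ] ⟩
  reading rs ++ r ++ [ x ]    ≡⟨ cong (reading rs ++_) (RowInsert-appended ins) ⟨
  reading rs ++ r′            ∎)
  where open ≡-Reasoning
... | r′ , just b  | ins = begin
  (reading rs ++ r) ++ [ x ]   ≡⟨ ++-assoc (reading rs) r [ x ] ⟩
  reading rs ++ r ++ [ x ]     ≈⟨ ≈ᴷ-++ˡ (reading rs) (RowInsert-knuth inc (inserted∉topRow rs u) ins) ⟩
  reading rs ++ b ∷ r′         ≡⟨ ++-assoc (reading rs) [ b ] r′ ⟨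
  (reading rs ++ [ b ]) ++ r′  ≈⟨ ≈ᴷ-++ʳ r′ (insert-knuth b rs incs (bumped-unique rs u (RowInsert-bumped-⊆ ins))) ⟩
  reading (insert b rs) ++ r′  ∎
  where open ≈ᴷ-Reasoning

insertAll-knuth : ∀ w T → IsTableau T → Unique (reading T ++ w) →
                  reading T ++ w ≈ᴷ reading (foldl (flip insert) T w) × IsTableau (foldl (flip insert) T w)
insertAll-knuth []      T t _ = ≡⇒≈ᴷ (++-identityʳ (reading T)) , t
insertAll-knuth (x ∷ w) T t u = (begin
  reading T ++ x ∷ w                      ≡⟨ ++-assoc (reading T) [ x ] w ⟨
  (reading T ++ [ x ]) ++ w               ≈⟨ ≈ᴷ-++ʳ w kₓ ⟩
  reading (insert x T) ++ w               ≈⟨ proj₁ rest ⟩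
  reading (foldl (flip insert) T (x ∷ w)) ∎) , proj₂ rest
  where
  open ≈ᴷ-Reasoning
  u⁺ : Unique ((reading T ++ [ x ]) ++ w)
  u⁺ = subst Unique (sym (++-assoc (reading T) [ x ] w)) u
  uₓ : Unique (reading T ++ [ x ])
  uₓ = Unique-resp-⊇ (++⁺ʳ w ⊆-refl) u⁺
  kₓ : reading T ++ [ x ] ≈ᴷ reading (insert x T)
  kₓ = insert-knuth x T (rowsIncreasing t) uₓ
  rest : reading (insert x T) ++ w ≈ᴷ reading (foldl (flip insert) T (x ∷ w)) × IsTableau (foldl (flip insert) T (x ∷ w))
  rest = insertAll-knuth w (insert x T) (insert-isTableau x T t uₓ)
           (Unique-resp-↭ (↭.++⁺ʳ w (≈ᴷ⇒↭ kₓ)) u⁺)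

P-knuth : ∀ {w} → Unique w → w ≈ᴷ reading (P w)
P-knuth {w} u = proj₁ (insertAll-knuth w [] isTableau-[] u)

P-isTableau : ∀ {w} → Unique w → IsTableau (P w)
P-isTableau {w} u = proj₂ (insertAll-knuth w [] isTableau-[] u)

-- Cells and the doubled reading word

infix 4 _[_]=_

data _[_]=_ : List ℕ → ℕ → ℕ → Set where
  here  : ∀ {a r} → a ∷ r [ 0 ]= a
  there : ∀ {b r q a} → r [ q ]= a → b ∷ r [ suc q ]= a

[]=-lookup : ∀ r {q} → q < length r → ∃ (r [ q ]=_)
[]=-lookup (a ∷ r) {zero}  _         = a , here
[]=-lookup (_ ∷ r) {suc q} (s≤s q<r) with []=-lookup r q<r
... | a , r[q]=a = a , there r[q]=a

[]=⇒⊆ : ∀ {r q a} → r [ q ]= a → [ a ] ⊆ r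
[]=⇒⊆ here              = refl ∷ minimum _
[]=⇒⊆ (there {b} r[q]=a) = b ∷ʳ []=⇒⊆ r[q]=a

[]=⇒split : ∀ {r q a} → r [ q ]= a → ∃₂ λ p r′ → r ≡ p ++ a ∷ r′ × length p ≡ q
[]=⇒split here = [] , _ , refl , refl
[]=⇒split (there {b} r[q]=a) with []=⇒split r[q]=a
... | p , r′ , refl , refl = b ∷ p , r′ , refl , refl

◁-[]= : ∀ {r s q b} → r ◁ s → s [ q ]= b → ∃ λ a → r [ q ]= a × a < b
◁-[]= (a<b ∷ _)   here            = _ , here , a<b
◁-[]= (_   ∷ r◁s) (there s[q]=b) with ◁-[]= r◁s s[q]=b
... | a , r[q]=a , a<b = a , there r[q]=a , a<b

data Cell : Tableau → ℕ → ℕ → Set where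
  top   : ∀ {r rs q a} → r [ q ]= a → Cell (r ∷ rs) 0 q
  below : ∀ {r rs i q} → Cell rs i q → Cell (r ∷ rs) (suc i) q

⊆-reverseReading : ∀ {a r rs xs} → [ a ] ⊆ r → xs ⊆ reverse (reading rs) → a ∷ xs ⊆ reverse (reading (r ∷ rs))
⊆-reverseReading {r = r} {rs} a∈r xs⊆ = subst (_ ⊆_) (sym (reverse-++ (reading rs) r)) (++⁺ (reverse⁺ a∈r) xs⊆)

column : ∀ {r rs i q} → Linked _◁_ (r ∷ rs) → Cell (r ∷ rs) i q →
         ∃₂ λ a c → r [ q ]= a × Increasing (a ∷ c) × length c ≡ i × a ∷ c ⊆ reverse (reading (r ∷ rs))
column {rs = rs} _ (top r[q]=a) = _ , [] , r[q]=a , [-] , refl , ⊆-reverseReading {rs = rs} ([]=⇒⊆ r[q]=a) (minimum _)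
column {rs = rs} (r◁s ∷ ◁ss) (below cell) with column ◁ss cell
... | b , c , s[q]=b , inc , len , sub with ◁-[]= r◁s s[q]=b
... | a , r[q]=a , a<b = a , b ∷ c , r[q]=a , a<b ∷ inc , cong suc len , ⊆-reverseReading {rs = rs} ([]=⇒⊆ r[q]=a) sub

cell⇒doubled : ∀ {T i q} → IsTableau T → Cell T i q → Doubled (suc (q + i)) (reading T)
cell⇒doubled {r ∷ rs} t cell with column (columnsStrict t) cell
... | a , c , r[q]=a , inc , refl , sub with []=⇒split r[q]=a
... | p , r′ , refl , refl =
  p ++ a ∷ c ,
  ++⁺ (++⁺ˡ (reading rs) (++⁺ʳ (a ∷ r′) ⊆-refl)) sub ,
  Linked-splice p (All.head (rowsIncreasing t)) inc ,
  trans (length-++ p) (+-suc (length p) (length c))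

-- Shapes with k(k-1)/2 boxes

staircase-or-cell : ∀ m T → All (0 <_) (shape T) →
                    Prefix _≤_ (shape T) (staircase (suc m)) ⊎ ∃₂ λ i q → q + i ≡ m × Cell T i q
staircase-or-cell m [] _ = inj₁ []
staircase-or-cell m (r ∷ rs) (r>0 ∷ pos) with length r ≤? m
... | no r≰m = inj₂ (0 , m , +-identityʳ m , top (proj₂ ([]=-lookup r (≰⇒> r≰m))))
staircase-or-cell zero    (r ∷ rs) (r>0 ∷ pos) | yes r≤0 = ⊥-elim (<⇒≱ r>0 r≤0)
staircase-or-cell (suc m) (r ∷ rs) (r>0 ∷ pos) | yes r≤m with staircase-or-cell m rs pos
... | inj₁ fits                   = inj₁ (r≤m ∷ fits)
... | inj₂ (i , q , q+i≡m , cell) = inj₂ (suc i , q , trans (+-suc q i) (cong suc q+i≡m) , below cell)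

Prefix-sum-≤ : ∀ {l s} → Prefix _≤_ l s → sum l ≤ sum s
Prefix-sum-≤ []          = z≤n
Prefix-sum-≤ (a≤b ∷ l≤s) = +-mono-≤ a≤b (Prefix-sum-≤ l≤s)

Prefix-sum-≥⇒≡ : ∀ {l s} → All (0 <_) s → Prefix _≤_ l s → sum s ≤ sum l → l ≡ s
Prefix-sum-≥⇒≡ []        []          _     = refl
Prefix-sum-≥⇒≡ (b>0 ∷ _) []          b+s≤0 = ⊥-elim (<⇒≱ b>0 (≤-trans (m≤m+n _ _) b+s≤0))
Prefix-sum-≥⇒≡ (_ ∷ pos) (a≤b ∷ l≤s) h     with ≤-+-squeeze a≤b (Prefix-sum-≤ l≤s) h
... | refl , s≤l = cong (_ ∷_) (Prefix-sum-≥⇒≡ pos l≤s s≤l)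

staircase-positive : ∀ k → All (0 <_) (staircase k)
staircase-positive k = All.map⁺ (All.universal (λ _ → z<s) _)

sum-staircase : ∀ m → sum (staircase (suc m)) ≡ suc m C 2
sum-staircase zero    = refl
sum-staircase (suc m) = begin
  suc m + sum (staircase (suc m))  ≡⟨ cong₂ _+_ (sym (nC1≡n (suc m))) (sum-staircase m) ⟩
  suc m C 1 + suc m C 2           ≡⟨ nCk+nC[k+1]≡[n+1]C[k+1] (suc m) 1 ⟩
  suc (suc m) C 2                 ∎
  where open ≡-Reasoning

sum-shape : ∀ T → sum (shape T) ≡ length (reading T)
sum-shape []       = refl
sum-shape (r ∷ rs) = begin
  length r + sum (shape rs)          ≡⟨ cong (length r +_) (sum-shape rs) ⟩
  length r + length (reading rs)     ≡⟨ +-comm (length r) (length (reading rs)) ⟩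
  length (reading rs) + length r     ≡⟨ length-++ (reading rs) ⟨
  length (reading rs ++ r)           ∎
  where open ≡-Reasoning

word-unique : ∀ {n} (π : Permutation′ n) → Unique (word π)
word-unique {n} π = Unique.map⁺ toℕ∘π-injective (Unique.allFin⁺ n)
  where
  toℕ∘π-injective : ∀ {i j} → toℕ (π ⟨$⟩ʳ i) ≡ toℕ (π ⟨$⟩ʳ j) → i ≡ j
  toℕ∘π-injective {i} {j} eq = trans (sym (inverseˡ π)) (trans (cong (π ⟨$⟩ˡ_) (toℕ-injective eq)) (inverseˡ π))

word-length : ∀ {n} (π : Permutation′ n) → length (word π) ≡ n
word-length {n} π = trans (length-map _ (allFin n)) (length-tabulate _)

sum-shape-P-word : ∀ {n} (π : Permutation′ n) → sum (shape (P (word π))) ≡ n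
sum-shape-P-word {n} π = begin
  sum (shape (P (word π)))       ≡⟨ sum-shape (P (word π)) ⟩
  length (reading (P (word π)))  ≡⟨ ↭-length (≈ᴷ⇒↭ (P-knuth (word-unique π))) ⟨
  length (word π)                ≡⟨ word-length π ⟩
  n                              ∎
  where open ≡-Reasoning

lemma4 : (k : ℕ) → 2 ≤ k → (π : Permutation′ (k C 2))
    → shape (P (word π)) ≢ staircase k
    → HasIncSubseq k (word π ++ reverse (word π))
lemma4 (suc (suc m)) (s≤s (s≤s _)) π shape≢staircase
  with staircase-or-cell (suc m) (P (word π)) (shapePositive (P-isTableau (word-unique π)))
... | inj₁ fits = ⊥-elim (shape≢staircase (Prefix-sum-≥⇒≡ (staircase-positive (suc (suc m))) fits
                    (≤-reflexive (trans (sum-staircase (suc m)) (sym (sum-shape-P-word π))))))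
... | inj₂ (i , q , q+i≡k-1 , cell) =
  ≈ᴷ-doubled (≈ᴷ-sym (P-knuth (word-unique π)))
    (subst (λ n → Doubled (suc n) (reading (P (word π)))) q+i≡k-1 (cell⇒doubled (P-isTableau (word-unique π)) cell))
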